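{- Consider a graph with positive integer edge weights, where $d(v)$ denotes the sum of the weights of edges incident to $v$. Let $U,V$ be disjoint vertex sets such that every edge incident to $U$ has its other endpoint in $V$. Let $V=\{v_1,\dots,v_n\}$ and $U=W\cup X$ (disjoint) with $W=\{w_1,\dots,w_n\}$ and $|X|=cn$ for some $c<1$. Let $\Delta$ be a positive integer and suppose: (Constraint 1) for every edge $(u,v)$ between $U$ and $V$, $d(u)+d(v)\le\Delta$; (Constraint 2) for every $i=1,\dots,n$, $d(v_i)+d(w_i)\ge\Delta-1$. Then the average of $d(x)$ over $x\in X$ is at most $\frac{\Delta}{2+c}+\frac{1}{c}$. -}

module Defs where

open import Data.Nat using (ℕ; zero; suc; _+_)
open import Data.Fin using (Fin; zero; suc)

∑ : (k : ℕ) → (Fin k → ℕ) → ℕ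
∑ zero    f = 0
∑ (suc k) f = f zero + ∑ k (λ i → f (suc i))

-- A weighted graph on vertex set Fin N is given by a symmetric weight
-- function wt : Fin N → Fin N → ℕ with zero diagonal; wt a b = 0 means
-- "no edge", wt a b > 0 is the (positive integer) weight of edge ab.
deg : (N : ℕ) → (Fin N → Fin N → ℕ) → Fin N → ℕ
deg N wt v = ∑ N (wt v)

open import Data.Nat using (_*_; NonZero)

instance
  nonZero-2n+m : ∀ {n m} → .{{NonZero n}} → NonZero (2 * n + m)
  nonZero-2n+m {suc k} = _

module Submission where

-- With K = 2n + m let f(a) = K²a − 2Δn², truncated at 0, and φ(t) = f(t)/t, which is nondecreasing.
-- Every neighbour v of a vertex u ∈ U has d(u) ≤ t_v := Δ − d(v), so
-- f(d(u)) = Σ_v w(u,v) φ(d(u)) ≤ Σ_v w(u,v) φ(t_v); summing over U charges each v at most d(v) φ(t_v).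
-- For v = v_i, Constraint 2 and 2(t m − e n)² ≥ 0, with t = t_v and e = d(v) − t, give
-- d(v) φ(t_v) ≤ f(d(w_i)) + K² + Δm². The terms f(d(w_i)) cancel, leaving Σ_X f(d(x)) ≤ n(K² + Δm²),
-- which rearranges to the bound on the average.

open import Defs using (∑; deg)
open import Data.Nat using (ℕ; zero; suc; _+_; _*_; _∸_; _≤_; _<_; z≤n; s≤s; NonZero; nonZero)
import Data.Nat.Properties as ℕ
open import Data.Nat.Tactic.RingSolver using (solve-∀)
open import Data.Fin using (Fin; zero; suc; _≟_)
open import Data.Fin.Properties using (any?; 0≢1+n; suc-injective)
open import Data.Product using (∃; _,_)
open import Data.Sum using (inj₁; inj₂; [_,_]′)
open import Data.Integer using (+_)
import Data.Integer as ℤ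
import Data.Integer.Properties as ℤ
open import Data.Rational using (ℚ; _/_) renaming (_≤_ to _≤ℚ_; _+_ to _+ℚ_)
import Data.Rational as ℚ
import Data.Rational.Properties as ℚ
open import Data.Rational.Unnormalised using (mkℚᵘ; *≡*; *≤*) renaming (_≃_ to _≃ᵘ_; _+_ to _+ᵘ_; _*_ to _*ᵘ_)
import Data.Rational.Unnormalised.Properties as ℚᵘ
open import Algebra.Bundles using (CommutativeRing; CommutativeMonoid)
import Algebra.Properties.Semiring.Sum (CommutativeRing.semiring ℚ.+-*-commutativeRing) as ℚΣ
open ℚΣ using (sum)
open import Algebra.Properties.CommutativeSemigroup (CommutativeMonoid.commutativeSemigroup ℚ.*-1-commutativeMonoid)
  using (xy∙z≈xz∙y)
open import Algebra.Properties.CommutativeSemigroup ℕ.+-commutativeSemigroup using (interchange)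
open import Function using (_∘_)
open import Relation.Nullary using (yes; no; contradiction)
open import Relation.Binary.PropositionalEquality
  using (_≡_; _≢_; refl; sym; trans; cong; cong₂; subst; subst₂; module ≡-Reasoning)

∑-cong : ∀ k {g h : Fin k → ℕ} → (∀ i → g i ≡ h i) → ∑ k g ≡ ∑ k h
∑-cong zero    g≡h = refl
∑-cong (suc k) g≡h = cong₂ _+_ (g≡h zero) (∑-cong k (g≡h ∘ suc))

∑-mono-≤ : ∀ k {g h : Fin k → ℕ} → (∀ i → g i ≤ h i) → ∑ k g ≤ ∑ k h
∑-mono-≤ zero    g≤h = z≤n
∑-mono-≤ (suc k) g≤h = ℕ.+-mono-≤ (g≤h zero) (∑-mono-≤ k (g≤h ∘ suc))

∑-const : ∀ k c → ∑ k (λ _ → c) ≡ k * c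
∑-const zero    c = refl
∑-const (suc k) c = cong (_+_ c) (∑-const k c)

∑-zero : ∀ k {g : Fin k → ℕ} → (∀ i → g i ≡ 0) → ∑ k g ≡ 0
∑-zero k g≡0 = trans (∑-cong k g≡0) (trans (∑-const k 0) (ℕ.*-zeroʳ k))

∑-distrib-+ : ∀ k (g h : Fin k → ℕ) → ∑ k (λ i → g i + h i) ≡ ∑ k g + ∑ k h
∑-distrib-+ zero    g h = refl
∑-distrib-+ (suc k) g h =
  trans (cong (_+_ (g zero + h zero)) (∑-distrib-+ k (g ∘ suc) (h ∘ suc)))
        (interchange (g zero) (h zero) (∑ k (g ∘ suc)) (∑ k (h ∘ suc)))

*-distribˡ-∑ : ∀ k c (g : Fin k → ℕ) → c * ∑ k g ≡ ∑ k (λ i → c * g i)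
*-distribˡ-∑ zero    c g = ℕ.*-zeroʳ c
*-distribˡ-∑ (suc k) c g =
  trans (ℕ.*-distribˡ-+ c (g zero) _) (cong (_+_ (c * g zero)) (*-distribˡ-∑ k c (g ∘ suc)))

∑-comm : ∀ p q (g : Fin p → Fin q → ℕ) →
         ∑ p (λ i → ∑ q (g i)) ≡ ∑ q (λ j → ∑ p (λ i → g i j))
∑-comm zero    q g = sym (∑-zero q (λ _ → refl))
∑-comm (suc p) q g = trans (cong (_+_ (∑ q (g zero))) (∑-comm p q (g ∘ suc)))
                           (sym (∑-distrib-+ q (g zero) (λ j → ∑ p (λ i → g (suc i) j))))

term≤∑ : ∀ k (g : Fin k → ℕ) i → g i ≤ ∑ k g
term≤∑ (suc k) g zero    = ℕ.m≤m+n (g zero) _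
term≤∑ (suc k) g (suc i) = ℕ.≤-trans (term≤∑ k (g ∘ suc) i) (ℕ.m≤n+m _ (g zero))

δ : ∀ {N} → Fin N → Fin N → ℕ
δ zero    zero    = 1
δ zero    (suc _) = 0
δ (suc _) zero    = 0
δ (suc a) (suc b) = δ a b

δ-refl : ∀ {N} (a : Fin N) → δ a a ≡ 1
δ-refl zero    = refl
δ-refl (suc a) = δ-refl a

δ-≢ : ∀ {N} {a b : Fin N} → a ≢ b → δ a b ≡ 0
δ-≢ {a = zero}  {zero}  a≢b = contradiction refl a≢b
δ-≢ {a = zero}  {suc b} a≢b = refl
δ-≢ {a = suc a} {zero}  a≢b = refl
δ-≢ {a = suc a} {suc b} a≢b = δ-≢ (a≢b ∘ cong suc)

∑-δ : ∀ N (h : Fin N → ℕ) a → ∑ N (λ y → h y * δ a y) ≡ h a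
∑-δ (suc N) h zero    = trans (cong₂ _+_ (ℕ.*-identityʳ (h zero)) (∑-zero N (λ y → ℕ.*-zeroʳ (h (suc y)))))
                              (ℕ.+-identityʳ (h zero))
∑-δ (suc N) h (suc a) = trans (cong (_+ ∑ N (λ y → h (suc y) * δ a y)) (ℕ.*-zeroʳ (h zero))) (∑-δ N (h ∘ suc) a)

count : ∀ {p N} → (Fin p → Fin N) → Fin N → ℕ
count {p} g y = ∑ p (λ i → δ (g i) y)

∑-reindex : ∀ {p} N (g : Fin p → Fin N) (h : Fin N → ℕ) →
            ∑ p (λ i → h (g i)) ≡ ∑ N (λ y → h y * count g y)
∑-reindex {p} N g h = begin
  ∑ p (λ i → h (g i))                      ≡⟨ ∑-cong p (λ i → sym (∑-δ N h (g i))) ⟩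
  ∑ p (λ i → ∑ N (λ y → h y * δ (g i) y))  ≡⟨ ∑-comm p N _ ⟩
  ∑ N (λ y → ∑ p (λ i → h y * δ (g i) y))  ≡⟨ ∑-cong N (λ y → sym (*-distribˡ-∑ p (h y) _)) ⟩
  ∑ N (λ y → h y * count g y)              ∎
  where open ≡-Reasoning

count-∉image : ∀ {p N} (g : Fin p → Fin N) {y} → (∀ i → g i ≢ y) → count g y ≡ 0
count-∉image {p} g g≢y = ∑-zero p (λ i → δ-≢ (g≢y i))

count-injective≤1 : ∀ {p N} (g : Fin p → Fin N) → (∀ i j → g i ≡ g j → i ≡ j) →
                    ∀ y → count g y ≤ 1
count-injective≤1 {zero}  g inj y = z≤n
count-injective≤1 {suc p} g inj y with g zero ≟ y
... | yes refl = ℕ.≤-reflexive (cong₂ _+_ (δ-refl (g zero))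
                   (count-∉image (g ∘ suc) (λ i gi≡g0 → 0≢1+n (inj zero (suc i) (sym gi≡g0)))))
... | no g0≢y  = subst (λ c → c + count (g ∘ suc) y ≤ 1) (sym (δ-≢ g0≢y))
                   (count-injective≤1 (g ∘ suc) (λ i j e → suc-injective (inj (suc i) (suc j) e)) y)

count-injective≡1 : ∀ {p N} (g : Fin p → Fin N) → (∀ i j → g i ≡ g j → i ≡ j) →
                    ∀ i → count g (g i) ≡ 1
count-injective≡1 {p} g inj i = ℕ.≤-antisym (count-injective≤1 g inj (g i))
  (subst (_≤ count g (g i)) (δ-refl (g i)) (term≤∑ p (λ j → δ (g j) (g i)) i))

∑-on-image : ∀ N {n} (V : Fin n → Fin N) → (∀ i j → V i ≡ V j → i ≡ j) →
             (h : Fin N → ℕ) → (∀ y → 0 < h y → ∃ λ j → y ≡ V j) →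
             ∑ N h ≡ ∑ n (λ j → h (V j))
∑-on-image N V inj h supp = sym (trans (∑-reindex N V h) (∑-cong N h*count≡h))
  where
  h*count≡h : ∀ y → h y * count V y ≡ h y
  h*count≡h y with h y ℕ.≟ 0
  ... | yes hy≡0 = trans (cong (_* count V y) hy≡0) (sym hy≡0)
  ... | no  hy≢0 with supp y (ℕ.n≢0⇒n>0 hy≢0)
  ...   | j , refl = trans (cong (h (V j) *_) (count-injective≡1 V inj j)) (ℕ.*-identityʳ _)

∑-disjoint-images≤ : ∀ N {p q} (X : Fin p → Fin N) (W : Fin q → Fin N) →
                     (∀ i j → X i ≡ X j → i ≡ j) → (∀ i j → W i ≡ W j → i ≡ j) →
                     (∀ i j → W i ≢ X j) → (h : Fin N → ℕ) →
                     ∑ p (λ k → h (X k)) + ∑ q (λ i → h (W i)) ≤ ∑ N h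
∑-disjoint-images≤ N {p} {q} X W X-inj W-inj W≢X h = begin
  ∑ p (λ k → h (X k)) + ∑ q (λ i → h (W i))
    ≡⟨ cong₂ _+_ (∑-reindex N X h) (∑-reindex N W h) ⟩
  ∑ N (λ y → h y * count X y) + ∑ N (λ y → h y * count W y)
    ≡⟨ sym (∑-distrib-+ N _ _) ⟩
  ∑ N (λ y → h y * count X y + h y * count W y)
    ≡⟨ ∑-cong N (λ y → sym (ℕ.*-distribˡ-+ (h y) (count X y) (count W y))) ⟩
  ∑ N (λ y → h y * (count X y + count W y))
    ≤⟨ ∑-mono-≤ N (λ y → ℕ.≤-trans (ℕ.*-monoʳ-≤ (h y) (count-+≤1 y)) (ℕ.≤-reflexive (ℕ.*-identityʳ (h y)))) ⟩
  ∑ N h ∎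
  where
  open ℕ.≤-Reasoning
  count-+≤1 : ∀ y → count X y + count W y ≤ 1
  count-+≤1 y with any? (λ k → X k ≟ y)
  ... | yes (k , Xk≡y) = subst (λ c → count X y + c ≤ 1)
                           (sym (count-∉image W (λ i Wi≡y → W≢X i k (trans Wi≡y (sym Xk≡y)))))
                           (subst (_≤ 1) (sym (ℕ.+-identityʳ _)) (count-injective≤1 X X-inj y))
  ... | no  ∄k         = subst (λ c → c + count W y ≤ 1)
                           (sym (count-∉image X (λ k Xk≡y → ∄k (k , Xk≡y))))
                           (count-injective≤1 W W-inj y)

-- Defs' instance nonZero-2n+m sends instance search for NonZero (suc t) into a loop, so fractions with
-- literal or successor denominators are built with the instance given explicitly.
_/1+_ : ℕ → ℕ → ℚ
a /1+ t = _/_ (+ a) (suc t) {{nonZero}}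

ι : ℕ → ℚ
ι a = a /1+ 0

toℚᵘ-/1+ : ∀ a t → ℚ.toℚᵘ (a /1+ t) ≃ᵘ mkℚᵘ (+ a) t
toℚᵘ-/1+ a t = ℚ.toℚᵘ-fromℚᵘ (mkℚᵘ (+ a) t)

*≡*⇒/≡/ : ∀ a b c d → a * suc d ≡ c * suc b → a /1+ b ≡ c /1+ d
*≡*⇒/≡/ a b c d ad≡cb = ℚ.toℚᵘ-injective (ℚᵘ.≃-trans (toℚᵘ-/1+ a b)
  (ℚᵘ.≃-trans (*≡* (trans (sym (ℤ.pos-* a (suc d))) (trans (cong +_ ad≡cb) (ℤ.pos-* c (suc b)))))
              (ℚᵘ.≃-sym (toℚᵘ-/1+ c d))))

*≤*⇒/≤/ : ∀ a b c d → a * suc d ≤ c * suc b → a /1+ b ≤ℚ c /1+ d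
*≤*⇒/≤/ a b c d ad≤cb = ℚ.toℚᵘ-cancel-≤ (ℚᵘ.≤-respˡ-≃ (ℚᵘ.≃-sym (toℚᵘ-/1+ a b))
  (ℚᵘ.≤-respʳ-≃ (ℚᵘ.≃-sym (toℚᵘ-/1+ c d))
    (*≤* (subst₂ ℤ._≤_ (ℤ.pos-* a (suc d)) (ℤ.pos-* c (suc b)) (ℤ.+≤+ ad≤cb)))))

-- The denominators are the predecessors of suc b * suc d.
/+/≡/ : ∀ a b c d → a /1+ b +ℚ c /1+ d ≡ (a * suc d + c * suc b) /1+ (d + b * suc d)
/+/≡/ a b c d = ℚ.toℚᵘ-injective (begin
  ℚ.toℚᵘ (a /1+ b +ℚ c /1+ d)                   ≈⟨ ℚ.toℚᵘ-homo-+ (a /1+ b) (c /1+ d) ⟩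
  ℚ.toℚᵘ (a /1+ b) +ᵘ ℚ.toℚᵘ (c /1+ d)          ≈⟨ ℚᵘ.+-cong (toℚᵘ-/1+ a b) (toℚᵘ-/1+ c d) ⟩
  mkℚᵘ (+ a) b +ᵘ mkℚᵘ (+ c) d                   ≡⟨ cong (λ z → mkℚᵘ z (d + b * suc d)) numerator ⟩
  mkℚᵘ (+ (a * suc d + c * suc b)) (d + b * suc d) ≈⟨ ℚᵘ.≃-sym (toℚᵘ-/1+ _ _) ⟩
  ℚ.toℚᵘ ((a * suc d + c * suc b) /1+ (d + b * suc d)) ∎)
  where
  open ℚᵘ.≃-Reasoning
  numerator : + a ℤ.* + suc d ℤ.+ + c ℤ.* + suc b ≡ + (a * suc d + c * suc b)
  numerator = sym (trans (ℤ.pos-+ (a * suc d) (c * suc b)) (cong₂ ℤ._+_ (ℤ.pos-* a (suc d)) (ℤ.pos-* c (suc b))))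

/*/≡/ : ∀ a b c d → a /1+ b ℚ.* c /1+ d ≡ (a * c) /1+ (d + b * suc d)
/*/≡/ a b c d = ℚ.toℚᵘ-injective (begin
  ℚ.toℚᵘ (a /1+ b ℚ.* c /1+ d)                  ≈⟨ ℚ.toℚᵘ-homo-* (a /1+ b) (c /1+ d) ⟩
  ℚ.toℚᵘ (a /1+ b) *ᵘ ℚ.toℚᵘ (c /1+ d)          ≈⟨ ℚᵘ.*-cong (toℚᵘ-/1+ a b) (toℚᵘ-/1+ c d) ⟩
  mkℚᵘ (+ a) b *ᵘ mkℚᵘ (+ c) d                   ≡⟨ cong (λ z → mkℚᵘ z (d + b * suc d)) (sym (ℤ.pos-* a c)) ⟩
  mkℚᵘ (+ (a * c)) (d + b * suc d)               ≈⟨ ℚᵘ.≃-sym (toℚᵘ-/1+ _ _) ⟩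
  ℚ.toℚᵘ ((a * c) /1+ (d + b * suc d)) ∎)
  where open ℚᵘ.≃-Reasoning

*≤*⇒/≤/+/ : ∀ D a b K m .{{_ : NonZero K}} .{{_ : NonZero m}} →
            D * K ≤ a * m + b * K → + D / m ≤ℚ + a / K +ℚ + b / m
*≤*⇒/≤/+/ D a b (suc k) (suc l) DK≤am+bK =
  subst (D /1+ l ≤ℚ_) (sym (/+/≡/ a k b l)) (*≤*⇒/≤/ D l (a * suc l + b * suc k) (l + k * suc l) (begin
    D * (suc k * suc l)             ≡⟨ ℕ.*-assoc D (suc k) (suc l) ⟨
    D * suc k * suc l               ≤⟨ ℕ.*-monoˡ-≤ (suc l) DK≤am+bK ⟩
    (a * suc l + b * suc k) * suc l ∎))
  where open ℕ.≤-Reasoning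

ι-+ : ∀ a b → ι (a + b) ≡ ι a +ℚ ι b
ι-+ a b = sym (trans (/+/≡/ a 0 b 0) (cong ι (cong₂ _+_ (ℕ.*-identityʳ a) (ℕ.*-identityʳ b))))

ι-* : ∀ a b → ι (a * b) ≡ ι a ℚ.* ι b
ι-* a b = sym (/*/≡/ a 0 b 0)

/1+-*-ι : ∀ a t → a /1+ t ℚ.* ι (suc t) ≡ ι a
/1+-*-ι a t = trans (/*/≡/ a t (suc t) 0) (*≡*⇒/≡/ (a * suc t) (t * 1) a 0 (ℕ.*-assoc a (suc t) 1))

/1+-nonNeg : ∀ a t → ℚ.NonNegative (a /1+ t)
/1+-nonNeg a t = ℚ.normalize-nonNeg a (suc t) {{nonZero}}

ι-pos : ∀ t → ℚ.Positive (ι (suc t))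
ι-pos t = ℚ.normalize-pos (suc t) 1 {{nonZero}} {{nonZero}}

ι-mono-≤ : ∀ {a b} → a ≤ b → ι a ≤ℚ ι b
ι-mono-≤ {a} {b} a≤b = *≤*⇒/≤/ a 0 b 0 (ℕ.*-monoˡ-≤ 1 a≤b)

ι-cancel-≤ : ∀ {a b} → ι a ≤ℚ ι b → a ≤ b
ι-cancel-≤ {a} {b} ιa≤ιb
  with ℚᵘ.≤-respʳ-≃ (toℚᵘ-/1+ b 0) (ℚᵘ.≤-respˡ-≃ (toℚᵘ-/1+ a 0) (ℚ.toℚᵘ-mono-≤ ιa≤ιb))
... | *≤* a*1≤b*1 = ℤ.drop‿+≤+ (subst₂ ℤ._≤_ (ℤ.*-identityʳ (+ a)) (ℤ.*-identityʳ (+ b)) a*1≤b*1)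

sum-mono-≤ : ∀ {k} {g h : Fin k → ℚ} → (∀ i → g i ≤ℚ h i) → sum g ≤ℚ sum h
sum-mono-≤ {zero}  g≤h = ℚ.≤-refl
sum-mono-≤ {suc k} g≤h = ℚ.+-mono-≤ (g≤h zero) (sum-mono-≤ (g≤h ∘ suc))

ι-∑ : ∀ k (g : Fin k → ℕ) → ι (∑ k g) ≡ sum (λ i → ι (g i))
ι-∑ zero    g = refl
ι-∑ (suc k) g = trans (ι-+ (g zero) _) (cong (_+ℚ_ (ι (g zero))) (ι-∑ k (g ∘ suc)))

m*n+m*n≤m*m+n*n : ∀ m n → m * n + m * n ≤ m * m + n * n
m*n+m*n≤m*m+n*n m n = [ ordered , swapped ]′ (ℕ.≤-total m n)
  where
  ordered : ∀ {a b} → a ≤ b → a * b + a * b ≤ a * a + b * b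
  ordered {a} a≤b with ℕ.m≤n⇒∃[o]m+o≡n a≤b
  ... | c , refl = subst (a * (a + c) + a * (a + c) ≤_) (expand a c) (ℕ.m≤m+n _ (c * c))
    where
    expand : ∀ a c → a * (a + c) + a * (a + c) + c * c ≡ a * a + (a + c) * (a + c)
    expand = solve-∀
  swapped : n ≤ m → m * n + m * n ≤ m * m + n * n
  swapped n≤m = subst₂ _≤_ (cong₂ _+_ (ℕ.*-comm n m) (ℕ.*-comm n m)) (ℕ.+-comm (n * n) (m * m)) (ordered n≤m)

-- Expanded, this says 2 (t m - e n)² ≥ 0.
square-bound : ∀ n m t e →
               (2 * n + m) * (2 * n + m) * t * e ≤ 2 * (t + e + t) * (n * n) * e + (t + e + t) * (m * m) * t
square-bound n m t e = ℕ.+-cancelʳ-≤ (2 * (t * m * (e * n) + t * m * (e * n))) _ _ (begin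
  (2 * n + m) * (2 * n + m) * t * e + 2 * (t * m * (e * n) + t * m * (e * n))
    ≤⟨ ℕ.+-monoʳ-≤ ((2 * n + m) * (2 * n + m) * t * e) (ℕ.*-monoʳ-≤ 2 (m*n+m*n≤m*m+n*n (t * m) (e * n))) ⟩
  (2 * n + m) * (2 * n + m) * t * e + 2 * (t * m * (t * m) + e * n * (e * n))
    ≡⟨ expand n m t e ⟩
  2 * (t + e + t) * (n * n) * e + (t + e + t) * (m * m) * t + 2 * (t * m * (e * n) + t * m * (e * n)) ∎)
  where
  open ℕ.≤-Reasoning
  expand : ∀ n m t e →
           (2 * n + m) * (2 * n + m) * t * e + 2 * (t * m * (t * m) + e * n * (e * n))
           ≡ 2 * (t + e + t) * (n * n) * e + (t + e + t) * (m * m) * t + 2 * (t * m * (e * n) + t * m * (e * n))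
  expand = solve-∀

module Potential (n m Δ : ℕ) where

  K : ℕ
  K = 2 * n + m

  A : ℕ
  A = 2 * Δ * (n * n)

  C : ℕ
  C = K * K + Δ * (m * m)

  f : ℕ → ℕ
  f a = K * K * a ∸ A

  φ : ℕ → ℚ
  φ zero    = ℚ.0ℚ
  φ (suc t) = f (suc t) /1+ t

  f-zero : f 0 ≡ 0
  f-zero = trans (cong (_∸ A) (ℕ.*-zeroʳ (K * K))) (ℕ.0∸n≡0 A)

  f-mono-≤ : ∀ {a b} → a ≤ b → f a ≤ f b
  f-mono-≤ a≤b = ℕ.∸-monoˡ-≤ A (ℕ.*-monoʳ-≤ (K * K) a≤b)

  f-suc≤ : ∀ a → f (suc a) ≤ f a + K * K
  f-suc≤ a = ℕ.m≤n+o⇒m∸n≤o (K * K * suc a) A (begin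
    K * K * suc a        ≡⟨ ℕ.*-suc (K * K) a ⟩
    K * K + K * K * a    ≤⟨ ℕ.+-monoʳ-≤ (K * K) (ℕ.m≤n+m∸n (K * K * a) A) ⟩
    K * K + (A + f a)    ≡⟨ rotate (K * K) A (f a) ⟩
    A + (f a + K * K)    ∎)
    where
    open ℕ.≤-Reasoning
    rotate : ∀ x y z → x + (y + z) ≡ y + (z + x)
    rotate = solve-∀

  f-ratio-mono : ∀ {a b} → a ≤ b → f a * b ≤ f b * a
  f-ratio-mono {a} {b} a≤b = begin
    (K * K * a ∸ A) * b     ≡⟨ ℕ.*-distribʳ-∸ b (K * K * a) A ⟩
    K * K * a * b ∸ A * b   ≤⟨ ℕ.∸-monoʳ-≤ (K * K * a * b) (ℕ.*-monoʳ-≤ A a≤b) ⟩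
    K * K * a * b ∸ A * a   ≡⟨ cong (_∸ A * a) (ℕ.*-assoc (K * K) a b) ⟩
    K * K * (a * b) ∸ A * a ≡⟨ cong (λ x → K * K * x ∸ A * a) (ℕ.*-comm a b) ⟩
    K * K * (b * a) ∸ A * a ≡⟨ cong (_∸ A * a) (ℕ.*-assoc (K * K) b a) ⟨
    K * K * b * a ∸ A * a   ≡⟨ ℕ.*-distribʳ-∸ a (K * K * b) A ⟨
    (K * K * b ∸ A) * a     ∎
    where open ℕ.≤-Reasoning

  φ-nonNeg : ∀ t → ℚ.NonNegative (φ t)
  φ-nonNeg zero    = /1+-nonNeg 0 0
  φ-nonNeg (suc t) = /1+-nonNeg (f (suc t)) t

  φ-mono-≤ : ∀ {a b} → a ≤ b → φ a ≤ℚ φ b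
  φ-mono-≤ {zero}  {b}     _         = ℚ.nonNegative⁻¹ (φ b) {{φ-nonNeg b}}
  φ-mono-≤ {suc a} {suc b} 1+a≤1+b   = *≤*⇒/≤/ (f (suc a)) a (f (suc b)) b (f-ratio-mono 1+a≤1+b)

  φ-*-ι : ∀ t → φ t ℚ.* ι t ≡ ι (f t)
  φ-*-ι zero    = trans (ℚ.*-zeroˡ (ι 0)) (cong ι (sym f-zero))
  φ-*-ι (suc t) = /1+-*-ι (f (suc t)) t

  excess-bound : ∀ t e → t + e + t ≡ Δ → f t * e ≤ Δ * (m * m) * t
  excess-bound t e t+e+t≡Δ = begin
    (K * K * t ∸ A) * e     ≡⟨ ℕ.*-distribʳ-∸ e (K * K * t) A ⟩
    K * K * t * e ∸ A * e   ≤⟨ ℕ.m≤n+o⇒m∸n≤o (K * K * t * e) (A * e)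
                                 (subst (λ Δ′ → K * K * t * e ≤ 2 * Δ′ * (n * n) * e + Δ′ * (m * m) * t)
                                        t+e+t≡Δ (square-bound n m t e)) ⟩
    Δ * (m * m) * t         ∎
    where open ℕ.≤-Reasoning

  complement-bound : ∀ y t → y + t ≡ Δ → f t * y ≤ (f t + Δ * (m * m)) * t
  complement-bound y t y+t≡Δ with ℕ.≤-total y t
  ... | inj₁ y≤t = ℕ.≤-trans (ℕ.*-monoʳ-≤ (f t) y≤t) (ℕ.*-monoˡ-≤ t (ℕ.m≤m+n (f t) _))
  ... | inj₂ t≤y with ℕ.m≤n⇒∃[o]m+o≡n t≤y
  ...   | e , refl = begin
    f t * (t + e)                 ≡⟨ ℕ.*-distribˡ-+ (f t) t e ⟩
    f t * t + f t * e             ≤⟨ ℕ.+-monoʳ-≤ (f t * t) (excess-bound t e y+t≡Δ) ⟩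
    f t * t + Δ * (m * m) * t     ≡⟨ ℕ.*-distribʳ-+ t (f t) (Δ * (m * m)) ⟨
    (f t + Δ * (m * m)) * t       ∎
    where open ℕ.≤-Reasoning

  vertex-bound-ℕ : ∀ y t z → y + t ≡ Δ → Δ ∸ 1 ≤ y + z → f t * y ≤ (C + f z) * t
  vertex-bound-ℕ y t z y+t≡Δ Δ-1≤y+z = begin
    f t * y                           ≤⟨ complement-bound y t y+t≡Δ ⟩
    (f t + Δ * (m * m)) * t           ≤⟨ ℕ.*-monoˡ-≤ t (ℕ.+-monoˡ-≤ (Δ * (m * m)) ft≤) ⟩
    (f z + K * K + Δ * (m * m)) * t   ≡⟨ cong (_* t) (trans (ℕ.+-assoc (f z) (K * K) _) (ℕ.+-comm (f z) C)) ⟩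
    (C + f z) * t                     ∎
    where
    open ℕ.≤-Reasoning
    t≤1+z : t ≤ suc z
    t≤1+z = ℕ.+-cancelˡ-≤ y t (suc z) (begin
      y + t            ≡⟨ y+t≡Δ ⟩
      Δ                ≤⟨ ℕ.m≤n+m∸n Δ 1 ⟩
      suc (Δ ∸ 1)      ≤⟨ s≤s Δ-1≤y+z ⟩
      suc (y + z)      ≡⟨ ℕ.+-suc y z ⟨
      y + suc z        ∎)
    ft≤ : f t ≤ f z + K * K
    ft≤ = ℕ.≤-trans (f-mono-≤ t≤1+z) (f-suc≤ z)

  vertex-bound : ∀ y z → Δ ∸ 1 ≤ y + z → φ (Δ ∸ y) ℚ.* ι y ≤ℚ ι (C + f z)
  vertex-bound y z Δ-1≤y+z with Δ ∸ y in Δ-y≡t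
  ... | zero  = ℚ.≤-trans (ℚ.≤-reflexive (ℚ.*-zeroˡ (ι y))) (ι-mono-≤ {0} {C + f z} z≤n)
  ... | suc t = ℚ.*-cancelʳ-≤-pos (ι (suc t)) {{ι-pos t}} (begin
    φ (suc t) ℚ.* ι y ℚ.* ι (suc t)   ≡⟨ xy∙z≈xz∙y (φ (suc t)) (ι y) (ι (suc t)) ⟩
    φ (suc t) ℚ.* ι (suc t) ℚ.* ι y   ≡⟨ cong (ℚ._* ι y) (φ-*-ι (suc t)) ⟩
    ι (f (suc t)) ℚ.* ι y             ≡⟨ ι-* (f (suc t)) y ⟨
    ι (f (suc t) * y)                 ≤⟨ ι-mono-≤ (vertex-bound-ℕ y (suc t) z y+t≡Δ Δ-1≤y+z) ⟩
    ι ((C + f z) * suc t)             ≡⟨ ι-* (C + f z) (suc t) ⟩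
    ι (C + f z) ℚ.* ι (suc t)         ∎)
    where
    open ℚ.≤-Reasoning
    y+t≡Δ : y + suc t ≡ Δ
    y+t≡Δ = trans (cong (_+_ y) (sym Δ-y≡t))
                  (ℕ.m+[n∸m]≡n (ℕ.<⇒≤ (ℕ.m∸n≢0⇒n<m {Δ} {y} (subst (_≢ 0) (sym Δ-y≡t) λ ()))))

  row-spread : ∀ {q} (r t : Fin q → ℕ) → (∀ j → 0 < r j → ∑ q r ≤ t j) →
               ι (f (∑ q r)) ≤ℚ sum (λ j → φ (t j) ℚ.* ι (r j))
  row-spread {q} r t r-short = begin
    ι (f d)                            ≡⟨ φ-*-ι d ⟨
    φ d ℚ.* ι d                        ≡⟨ cong (φ d ℚ.*_) (ι-∑ q r) ⟩
    φ d ℚ.* sum (λ j → ι (r j))        ≡⟨ ℚΣ.*-distribˡ-sum (φ d) (λ j → ι (r j)) ⟩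
    sum (λ j → φ d ℚ.* ι (r j))        ≤⟨ sum-mono-≤ edge ⟩
    sum (λ j → φ (t j) ℚ.* ι (r j))    ∎
    where
    open ℚ.≤-Reasoning
    d : ℕ
    d = ∑ q r
    edge : ∀ j → φ d ℚ.* ι (r j) ≤ℚ φ (t j) ℚ.* ι (r j)
    edge j with r j | r-short j
    ... | zero  | _    = ℚ.≤-reflexive (trans (ℚ.*-zeroʳ (φ d)) (sym (ℚ.*-zeroʳ (φ (t j)))))
    ... | suc a | d≤tj = ℚ.*-monoʳ-≤-nonNeg (ι (suc a)) {{/1+-nonNeg (suc a) 0}} (φ-mono-≤ (d≤tj (s≤s z≤n)))

  matrix-spread : ∀ {p q} (d : Fin p → ℕ) (R : Fin p → Fin q → ℕ) (t : Fin q → ℕ) →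
                  (∀ k → d k ≡ ∑ q (R k)) → (∀ k j → 0 < R k j → d k ≤ t j) →
                  sum (λ k → ι (f (d k))) ≤ℚ sum (λ j → φ (t j) ℚ.* ι (∑ p (λ k → R k j)))
  matrix-spread {p} {q} d R t d≡ R-short = begin
    sum (λ k → ι (f (d k)))                           ≡⟨ ℚΣ.sum-cong-≗ (λ k → cong (ι ∘ f) (d≡ k)) ⟩
    sum (λ k → ι (f (∑ q (R k))))                     ≤⟨ sum-mono-≤ (λ k → row-spread (R k) t (row-short k)) ⟩
    sum (λ k → sum (λ j → φ (t j) ℚ.* ι (R k j)))     ≡⟨ ℚΣ.∑-comm (λ k j → φ (t j) ℚ.* ι (R k j)) ⟩
    sum (λ j → sum (λ k → φ (t j) ℚ.* ι (R k j)))     ≡⟨ ℚΣ.sum-cong-≗ (λ j → sym (ℚΣ.*-distribˡ-sum (φ (t j)) (λ k → ι (R k j)))) ⟩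
    sum (λ j → φ (t j) ℚ.* sum (λ k → ι (R k j)))     ≡⟨ ℚΣ.sum-cong-≗ (λ j → cong (φ (t j) ℚ.*_) (ι-∑ p (λ k → R k j))) ⟨
    sum (λ j → φ (t j) ℚ.* ι (∑ p (λ k → R k j)))     ∎
    where
    open ℚ.≤-Reasoning
    row-short : ∀ k j → 0 < R k j → ∑ q (R k) ≤ t j
    row-short k j = subst (_≤ t j) (d≡ k) ∘ R-short k j

  potential-bound :
    (dX : Fin m → ℕ) (dW dV : Fin n → ℕ) (P : Fin m → Fin n → ℕ) (Q : Fin n → Fin n → ℕ) →
    (∀ k → dX k ≡ ∑ n (P k)) → (∀ i → dW i ≡ ∑ n (Q i)) →
    (∀ j → ∑ m (λ k → P k j) + ∑ n (λ i → Q i j) ≤ dV j) →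
    (∀ k j → 0 < P k j → dX k + dV j ≤ Δ) → (∀ i j → 0 < Q i j → dW i + dV j ≤ Δ) →
    (∀ j → Δ ∸ 1 ≤ dV j + dW j) →
    ∑ m (λ k → f (dX k)) ≤ n * C
  potential-bound dX dW dV P Q dX≡ dW≡ columns P-short Q-short VW-long =
    ℕ.+-cancelʳ-≤ FW FX (n * C) (ι-cancel-≤ (begin
      ι (FX + FW)
        ≡⟨ trans (ι-+ FX FW) (cong₂ _+ℚ_ (ι-∑ m (λ k → f (dX k))) (ι-∑ n (λ i → f (dW i)))) ⟩
      sum (λ k → ι (f (dX k))) +ℚ sum (λ i → ι (f (dW i)))
        ≤⟨ ℚ.+-mono-≤ (matrix-spread dX P t dX≡ (λ k j → ℕ.m+n≤o⇒m≤o∸n (dX k) ∘ P-short k j))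
                      (matrix-spread dW Q t dW≡ (λ i j → ℕ.m+n≤o⇒m≤o∸n (dW i) ∘ Q-short i j)) ⟩
      sum (λ j → φ (t j) ℚ.* ι (colP j)) +ℚ sum (λ j → φ (t j) ℚ.* ι (colQ j))
        ≡⟨ ℚΣ.∑-distrib-+ (λ j → φ (t j) ℚ.* ι (colP j)) (λ j → φ (t j) ℚ.* ι (colQ j)) ⟨
      sum (λ j → φ (t j) ℚ.* ι (colP j) +ℚ φ (t j) ℚ.* ι (colQ j))
        ≡⟨ ℚΣ.sum-cong-≗ (λ j → trans (sym (ℚ.*-distribˡ-+ (φ (t j)) _ _))
                                      (cong (φ (t j) ℚ.*_) (sym (ι-+ (colP j) (colQ j))))) ⟩
      sum (λ j → φ (t j) ℚ.* ι (colP j + colQ j))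
        ≤⟨ sum-mono-≤ (λ j → ℚ.*-monoˡ-≤-nonNeg (φ (t j)) {{φ-nonNeg (t j)}} (ι-mono-≤ (columns j))) ⟩
      sum (λ j → φ (t j) ℚ.* ι (dV j))
        ≤⟨ sum-mono-≤ (λ j → vertex-bound (dV j) (dW j) (VW-long j)) ⟩
      sum (λ j → ι (C + f (dW j)))
        ≡⟨ ι-∑ n (λ j → C + f (dW j)) ⟨
      ι (∑ n (λ j → C + f (dW j)))
        ≡⟨ cong ι (trans (∑-distrib-+ n (λ _ → C) (λ j → f (dW j))) (cong (_+ FW) (∑-const n C))) ⟩
      ι (n * C + FW) ∎))
    where
    open ℚ.≤-Reasoning
    FX FW : ℕ
    FX = ∑ m (λ k → f (dX k))
    FW = ∑ n (λ i → f (dW i))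
    t : Fin n → ℕ
    t j = Δ ∸ dV j
    colP colQ : Fin n → ℕ
    colP j = ∑ m (λ k → P k j)
    colQ j = ∑ n (λ i → Q i j)

  average-bound : .{{_ : NonZero n}} → (g : Fin m → ℕ) →
                  ∑ m (λ k → f (g k)) ≤ n * C → ∑ m g * K ≤ Δ * n * m + n * K
  average-bound g ∑fg≤nC = ℕ.*-cancelˡ-≤ K (begin
    K * (∑ m g * K)                   ≡⟨ rearrange K (∑ m g) ⟩
    K * K * ∑ m g                     ≡⟨ *-distribˡ-∑ m (K * K) g ⟩
    ∑ m (λ k → K * K * g k)           ≤⟨ ∑-mono-≤ m (λ k → ℕ.m≤n+m∸n (K * K * g k) A) ⟩
    ∑ m (λ k → A + f (g k))           ≡⟨ ∑-distrib-+ m (λ _ → A) (λ k → f (g k)) ⟩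
    ∑ m (λ _ → A) + ∑ m (λ k → f (g k)) ≡⟨ cong (_+ ∑ m (λ k → f (g k))) (∑-const m A) ⟩
    m * A + ∑ m (λ k → f (g k))       ≤⟨ ℕ.+-monoʳ-≤ (m * A) ∑fg≤nC ⟩
    m * A + n * C                     ≡⟨ expand n m Δ ⟩
    K * (Δ * n * m + n * K)           ∎)
    where
    open ℕ.≤-Reasoning
    rearrange : ∀ x y → x * (y * x) ≡ x * x * y
    rearrange = solve-∀
    expand : ∀ n m Δ → m * (2 * Δ * (n * n)) + n * ((2 * n + m) * (2 * n + m) + Δ * (m * m))
                       ≡ (2 * n + m) * (Δ * n * m + n * (2 * n + m))
    expand = solve-∀

lemma6 : (N : ℕ) (wt : Fin N → Fin N → ℕ)
         → (∀ a b → wt a b ≡ wt b a)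
         → (∀ a → wt a a ≡ 0)
         → (n m : ℕ) .{{_ : NonZero n}} .{{_ : NonZero m}}
         → (V W : Fin n → Fin N) (X : Fin m → Fin N)
         → (∀ i j → V i ≡ V j → i ≡ j)
         → (∀ i j → W i ≡ W j → i ≡ j)
         → (∀ i j → X i ≡ X j → i ≡ j)
         → (∀ i j → W i ≢ V j)
         → (∀ i j → X i ≢ V j)
         → (∀ i j → W i ≢ X j)
         → (∀ i y → 0 < wt (W i) y → ∃ λ j → y ≡ V j)
         → (∀ i y → 0 < wt (X i) y → ∃ λ j → y ≡ V j)
         → m < n
         → (Δ : ℕ) → 0 < Δ
         → (∀ i j → 0 < wt (W i) (V j) → deg N wt (W i) + deg N wt (V j) ≤ Δ)
         → (∀ i j → 0 < wt (X i) (V j) → deg N wt (X i) + deg N wt (V j) ≤ Δ)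
         → (∀ i → Δ ∸ 1 ≤ deg N wt (V i) + deg N wt (W i))
         → (+ ∑ m (λ k → deg N wt (X k))) / m
             ≤ℚ ((+ (Δ * n)) / (2 * n + m) +ℚ (+ n) / m)
lemma6 N wt wt-sym _ n m V W X V-inj W-inj X-inj _ _ W≢X W-adj X-adj _ Δ _ W-short X-short VW-long =
  *≤*⇒/≤/+/ (∑ m (d ∘ X)) (Δ * n) n K m (average-bound (d ∘ X)
    (potential-bound (d ∘ X) (d ∘ W) (d ∘ V) P Q (row X X-adj) (row W W-adj) column X-short W-short VW-long))
  where
  open Potential n m Δ
  d : Fin N → ℕ
  d = deg N wt
  P : Fin m → Fin n → ℕ
  P k j = wt (X k) (V j)
  Q : Fin n → Fin n → ℕ
  Q i j = wt (W i) (V j)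
  row : ∀ {p} (U : Fin p → Fin N) → (∀ i y → 0 < wt (U i) y → ∃ λ j → y ≡ V j) →
        ∀ i → d (U i) ≡ ∑ n (λ j → wt (U i) (V j))
  row U U-adj i = ∑-on-image N V V-inj (wt (U i)) (U-adj i)
  column : ∀ j → ∑ m (λ k → P k j) + ∑ n (λ i → Q i j) ≤ d (V j)
  column j = subst₂ (λ x y → x + y ≤ d (V j)) (∑-cong m (λ k → wt-sym (V j) (X k))) (∑-cong n (λ i → wt-sym (V j) (W i)))
                    (∑-disjoint-images≤ N X W X-inj W-inj W≢X (wt (V j)))
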